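{- Let $\tau$ be a set of positions and $x$ be any variable. Let $\tau^+$ be the set of positions with associated terms defined by: for each $p\in\Pi$, $\tau^+(p)$ is the function with domain $\tau(p)$ mapping every element of $\tau(p)$ to $x$. Then: (1) an atom $A$ is $\Delta[\tau]$-more general than an atom $B$ iff $A$ is $\Delta[\tau^+]$-more general than $B$; (2) for any clause $c$, $\tau$ is DN for $c$ iff $\tau^+$ is DN for $c$.
   Context: Fix a first-order language $\mathcal L$; $\Pi$ is its set of relation symbols, each $p$ with unique arity $arity(p)$; $TU_{\mathcal L}$ is the set of all terms; $[1,n]=\{1,\dots,n\}$. A term-condition is a map $TU_{\mathcal L}\to\{\mathtt{true},\mathtt{false}\}$. A filter $\Delta$ assigns to each $p\in\Pi$ a partial function $\Delta(p)$ from $[1,arity(p)]$ to term-conditions. An atom $A=p(s_1,\dots,s_n)$ is $\Delta$-more general than $B$ if there is a substitution $\eta$ with $B=p(t_1,\dots,t_n)$, $t_i=s_i\eta$ for $i\notin Dom(\Delta(p))$, and $\Delta(p)(i)(s_i)=\mathtt{true}$ for $i\in Dom(\Delta(p))$. A set of positions $\tau$ maps each $p\in\Pi$ to a subset $\tau(p)\subseteq[1,arity(p)]$; its associated filter $\Delta[\tau]$ maps $p$ to the function with domain $\tau(p)$ sending each $i$ to the term-condition $t\mapsto\mathtt{true}$ (for all $t$). $\tau$ is DN for a clause $p(s_1,\dots,s_n)\leftarrow\mathbf B$ if for every $i\in\tau(p)$: $s_i$ is a variable, $s_i$ occurs only once in $p(s_1,\dots,s_n)$, and for each atom $q(t_1,\dots,t_m)$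 in $\mathbf B$ and each $j\in[1,m]$, $s_i\in Var(t_j)$ implies $j\in\tau(q)$. A set of positions with associated terms $\tau^+$ assigns to each $p$ a partial function $\tau^+(p)$ from $[1,arity(p)]$ to $TU_{\mathcal L}$; write $\langle i\mapsto u\rangle\in\tau^+(p)$ if $i\in Dom(\tau^+(p))$ and $\tau^+(p)(i)=u$. Its associated filter $\Delta[\tau^+]$ maps $p$ to the function with domain $Dom(\tau^+(p))$ sending $i$ to the term-condition $t\mapsto\mathtt{true}$ iff $t$ is an instance of $\tau^+(p)(i)$. $\tau^+$ is DN for a clause $p(s_1,\dots,s_n)\leftarrow\mathbf B$ if: (DN1) for all $i\in Dom(\tau^+(p))$, $j\in[1,n]\setminus\{i\}$: $Var(s_i)\cap Var(s_j)=\emptyset$; (DN2) for all $\langle i\mapsto u_i\rangle\in\tau^+(p)$, $s_i$ is more general than $u_i$; (DN3) for all $i\in Dom(\tau^+(p))$, all atoms $q(t_1,\dots,t_m)$ in $\mathbf B$, all $j\in[1,m]\setminus Dom(\tau^+(q))$: $Var(s_i)\cap Var(t_j)=\emptyset$; (DN4) for all atoms $q(t_1,\dots,t_m)$ in $\mathbf B$ and all $\langle j\mapsto u_j\rangle\in\tau^+(q)$, $t_j$ is an instance of $u_j$. -}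

module Defs where

open import Data.Nat using (ℕ)
open import Data.Fin using (Fin)
open import Data.Vec using (Vec; []; _∷_; lookup)
open import Data.List using (List)
open import Data.List.Membership.Propositional using (_∈_)
open import Data.Bool using (Bool; true; false)
open import Data.Maybe using (Maybe; just; nothing)
open import Data.Unit using (⊤)
open import Data.Empty using (⊥)
open import Data.Product using (Σ; ∃; _×_; _,_)
open import Relation.Binary.PropositionalEquality using (_≡_; _≢_)
open import Relation.Nullary using (¬_)

record Language : Set₁ where
  field
    Fun      : Set
    funArity : Fun → ℕ
    Rel      : Set
    arity    : Rel → ℕ

module _ (L : Language) where
  open Language L

  Var : Set
  Var = ℕ

  data Term : Set where
    var : Var → Term
    app : (f : Fun) → Vec Term (funArity f) → Term

  Subst : Set
  Subst = Var → Term

  mutual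
    _⟨_⟩ : Term → Subst → Term
    var v ⟨ η ⟩ = η v
    app f ts ⟨ η ⟩ = app f (ts ⟨ η ⟩*)

    _⟨_⟩* : ∀ {n} → Vec Term n → Subst → Vec Term n
    [] ⟨ η ⟩* = []
    (t ∷ ts) ⟨ η ⟩* = (t ⟨ η ⟩) ∷ (ts ⟨ η ⟩*)

  IsInstance : Term → Term → Set
  IsInstance t u = ∃ λ (σ : Subst) → t ≡ u ⟨ σ ⟩

  mutual
    data _occursIn_ (v : Var) : Term → Set where
      here : v occursIn var v
      there : ∀ {f ts} → v occursIn* ts → v occursIn app f ts

    data _occursIn*_ (v : Var) : ∀ {n} → Vec Term n → Set where
      hd : ∀ {n t} {ts : Vec Term n} → v occursIn t → v occursIn* (t ∷ ts)
      tl : ∀ {n t} {ts : Vec Term n} → v occursIn* ts → v occursIn* (t ∷ ts)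

  Disjoint : Term → Term → Set
  Disjoint s t = ∀ v → v occursIn s → ¬ (v occursIn t)

  -- Atoms p(s_1,…,s_n); positions [1,n] are represented by Fin n.
  record Atom : Set where
    constructor atom
    field
      pred : Rel
      args : Vec Term (arity pred)

  record Clause : Set where
    constructor _⇐_
    field
      head : Atom
      body : List Atom

  -- Term-conditions: maps TU_L → {true,false}, represented as predicates.
  TermCondition : Set₁
  TermCondition = Term → Set

  -- Partial functions [1,n] ⇀ X are  Fin n → Maybe X.
  -- Filters
  Filter : Set₁
  Filter = (p : Rel) → Fin (arity p) → Maybe TermCondition

  MoreGeneral : Filter → Atom → Atom → Set
  MoreGeneral Δ (atom p s) (atom q t) =
    Σ (p ≡ q) λ { _≡_.refl →
      ∃ λ (η : Subst) → ∀ (i : Fin (arity p)) → Cond (Δ p i) (lookup s i) (lookup t i) η }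
    where
      Cond : Maybe TermCondition → Term → Term → Subst → Set
      Cond nothing  sᵢ tᵢ η = tᵢ ≡ sᵢ ⟨ η ⟩
      Cond (just c) sᵢ tᵢ η = c sᵢ

  Positions : Set
  Positions = (p : Rel) → Fin (arity p) → Bool

  Δ[_] : Positions → Filter
  Δ[ τ ] p i with τ p i
  ... | true  = just (λ _ → ⊤)
  ... | false = nothing

  Positions⁺ : Set
  Positions⁺ = (p : Rel) → Fin (arity p) → Maybe Term

  Δ⁺[_] : Positions⁺ → Filter
  Δ⁺[ τ⁺ ] p i with τ⁺ p i
  ... | just u  = just (λ t → IsInstance t u)
  ... | nothing = nothing

  InDom : ∀ {n} → (Fin n → Maybe Term) → Fin n → Set
  InDom f i = ∃ λ u → f i ≡ just u

  DN : Positions → Clause → Set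
  DN τ (atom p s ⇐ B) =
    ∀ (i : Fin (arity p)) → τ p i ≡ true →
      ∃ λ (v : Var) → lookup s i ≡ var v
        × (∀ (j : Fin (arity p)) → j ≢ i → ¬ (v occursIn lookup s j))
        × (∀ (a : Atom) → a ∈ B → ∀ (j : Fin (arity (Atom.pred a))) →
             v occursIn lookup (Atom.args a) j → τ (Atom.pred a) j ≡ true)

  DN⁺ : Positions⁺ → Clause → Set
  DN⁺ τ⁺ (atom p s ⇐ B) =
    -- DN1
    (∀ (i : Fin (arity p)) → InDom (τ⁺ p) i → ∀ (j : Fin (arity p)) → j ≢ i →
       Disjoint (lookup s i) (lookup s j))
    -- DN2
    × (∀ (i : Fin (arity p)) (u : Term) → τ⁺ p i ≡ just u → IsInstance u (lookup s i))
    -- DN3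
    × (∀ (i : Fin (arity p)) → InDom (τ⁺ p) i → ∀ (a : Atom) → a ∈ B →
         ∀ (j : Fin (arity (Atom.pred a))) → ¬ InDom (τ⁺ (Atom.pred a)) j →
         Disjoint (lookup s i) (lookup (Atom.args a) j))
    -- DN4
    × (∀ (a : Atom) → a ∈ B → ∀ (j : Fin (arity (Atom.pred a))) (u : Term) →
         τ⁺ (Atom.pred a) j ≡ just u → IsInstance (lookup (Atom.args a) j) u)

  toPositions⁺ : Positions → Var → Positions⁺
  toPositions⁺ τ x p i with τ p i
  ... | true  = just (var x)
  ... | false = nothing

-- Every term is an instance of a variable, and a term more general than a variable is itself
-- a variable. Hence the condition "is an instance of x" that Δ[τ⁺] places on the τ-positions
-- accepts everything, just like the trivial condition of Δ[τ]; and in DN⁺, condition DN2 says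
-- exactly that sᵢ is a variable (DN4 holds outright), after which DN1 and DN3 say that this
-- variable occurs nowhere else in the head and only at τ-positions in the body.
module Submission where

open import Defs
open import Data.Bool using (true; false; _≟_)
open import Data.Fin using (Fin)
open import Data.List.Membership.Propositional using (_∈_)
open import Data.Maybe using (just; nothing)
open import Data.Maybe.Relation.Binary.Pointwise using (Pointwise; just; nothing)
open import Data.Product using (Σ; ∃; _×_; _,_)
open import Data.Unit using (tt)
open import Data.Vec using (Vec; lookup)
open import Function using (_∘_)
open import Function.Bundles using (_⇔_; mk⇔)
open import Relation.Binary.PropositionalEquality using (_≡_; _≢_; refl; sym; subst)
open import Relation.Nullary using (¬_)
open import Relation.Nullary.Decidable using (decidable-stable)

module _ (L : Language) where
  open Language L

  IsInstance-var : ∀ t v → IsInstance L t (var v)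
  IsInstance-var t v = (λ _ → t) , refl

  var-IsInstance⇒var : ∀ {x t} → IsInstance L (var x) t → ∃ λ v → t ≡ var v
  var-IsInstance⇒var {t = var v} _ = v , refl

  Disjoint-var : ∀ {v t} → ¬ (_occursIn_ L v t) → Disjoint L (var v) t
  Disjoint-var v∉t _ here = v∉t

  -- The per-position condition of `MoreGeneral` is local to its `where` block; it is recovered
  -- here by unification against the Σ- and Π-types that `MoreGeneral` unfolds to.
  private
    fibre : (T : Set) {A : Set} {B : A → Set} → T ≡ Σ A B → A → Set
    fibre _ {B = B} _ = B

    codomain : (T : Set) {A : Set} {B : A → Set} → T ≡ ((a : A) → B a) → A → Set
    codomain _ {B = B} _ = B

  PositionCondition : Filter L → (p : Rel) (s t : Vec (Term L) (arity p)) →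
                      Subst L → Fin (arity p) → Set
  PositionCondition Δ p s t η =
    codomain (fibre (fibre (MoreGeneral L Δ (atom p s) (atom p t)) refl refl) refl η) refl

  _⊑_ : Filter L → Filter L → Set₁
  Δ ⊑ Δ′ = ∀ p i → Pointwise (λ c c′ → ∀ t → c t → c′ t) (Δ p i) (Δ′ p i)

  PositionCondition-mono : ∀ {Δ Δ′} → Δ ⊑ Δ′ → ∀ {p} s t η i →
    PositionCondition Δ p s t η i → PositionCondition Δ′ p s t η i
  PositionCondition-mono {Δ} {Δ′} Δ⊑Δ′ {p} s t η i cond with Δ p i | Δ′ p i | Δ⊑Δ′ p i
  ... | just _  | just _  | just c⇒c′ = c⇒c′ (lookup s i) cond
  ... | nothing | nothing | nothing   = cond

  MoreGeneral-mono : ∀ {Δ Δ′} → Δ ⊑ Δ′ → ∀ A B → MoreGeneral L Δ A B → MoreGeneral L Δ′ A B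
  MoreGeneral-mono Δ⊑Δ′ (atom p s) (atom .p t) (refl , η , cond) =
    refl , η , λ i → PositionCondition-mono Δ⊑Δ′ s t η i (cond i)

module _ (L : Language) (τ : Positions L) (x : Var L) where
  private
    τ⁺ : Positions⁺ L
    τ⁺ = toPositions⁺ L τ x

  toPositions⁺-true : ∀ {p i} → τ p i ≡ true → τ⁺ p i ≡ just (var x)
  toPositions⁺-true {p} {i} τpi with τ p i
  toPositions⁺-true refl | true = refl

  toPositions⁺-just : ∀ {p i u} → τ⁺ p i ≡ just u → u ≡ var x
  toPositions⁺-just {p} {i} τ⁺pi with τ p i
  toPositions⁺-just refl | true = refl

  InDom-toPositions⁺ : ∀ {p i} → InDom L (τ⁺ p) i → τ p i ≡ true
  InDom-toPositions⁺ {p} {i} i∈dom with τ p i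
  InDom-toPositions⁺ _       | true = refl
  InDom-toPositions⁺ (_ , ()) | false

  Δ[τ]⊑Δ⁺[τ⁺] : _⊑_ L (Δ[_] L τ) (Δ⁺[_] L τ⁺)
  Δ[τ]⊑Δ⁺[τ⁺] p i with τ p i
  ... | true  = just (λ t _ → IsInstance-var L t x)
  ... | false = nothing

  Δ⁺[τ⁺]⊑Δ[τ] : _⊑_ L (Δ⁺[_] L τ⁺) (Δ[_] L τ)
  Δ⁺[τ⁺]⊑Δ[τ] p i with τ p i
  ... | true  = just (λ _ _ → tt)
  ... | false = nothing

  DN⇒DN⁺ : ∀ c → DN L τ c → DN⁺ L τ⁺ c
  DN⇒DN⁺ (atom p s ⇐ B) dn = dn1 , dn2 , dn3 , dn4
    where
    dn1 : ∀ i → InDom L (τ⁺ p) i → ∀ j → j ≢ i → Disjoint L (lookup s i) (lookup s j)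
    dn1 i i∈dom j j≢i with dn i (InDom-toPositions⁺ i∈dom)
    ... | v , sᵢ≡v , fresh , _ rewrite sᵢ≡v = Disjoint-var L (fresh j j≢i)

    dn2 : ∀ i u → τ⁺ p i ≡ just u → IsInstance L u (lookup s i)
    dn2 i u τ⁺pi with dn i (InDom-toPositions⁺ (u , τ⁺pi))
    ... | v , sᵢ≡v , _ rewrite sᵢ≡v = IsInstance-var L u v

    dn3 : ∀ i → InDom L (τ⁺ p) i → ∀ a → a ∈ B → ∀ j → ¬ InDom L (τ⁺ (Atom.pred a)) j →
          Disjoint L (lookup s i) (lookup (Atom.args a) j)
    dn3 i i∈dom a a∈B j j∉dom with dn i (InDom-toPositions⁺ i∈dom)
    ... | v , sᵢ≡v , _ , local rewrite sᵢ≡v =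
      Disjoint-var L (λ v∈tⱼ → j∉dom (var x , toPositions⁺-true (local a a∈B j v∈tⱼ)))

    dn4 : ∀ a → a ∈ B → ∀ j u → τ⁺ (Atom.pred a) j ≡ just u → IsInstance L (lookup (Atom.args a) j) u
    dn4 a _ j u τ⁺qj rewrite toPositions⁺-just τ⁺qj = IsInstance-var L (lookup (Atom.args a) j) x

  DN⁺⇒DN : ∀ c → DN⁺ L τ⁺ c → DN L τ c
  DN⁺⇒DN (atom p s ⇐ B) (dn1 , dn2 , dn3 , _) i τpi
    with var-IsInstance⇒var L (dn2 i (var x) (toPositions⁺-true τpi))
  ... | v , sᵢ≡v = v , sᵢ≡v , fresh , local
    where
    i∈dom : InDom L (τ⁺ p) i
    i∈dom = var x , toPositions⁺-true τpi

    v∈sᵢ : _occursIn_ L v (lookup s i)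
    v∈sᵢ = subst (_occursIn_ L v) (sym sᵢ≡v) here

    fresh : ∀ j → j ≢ i → ¬ (_occursIn_ L v (lookup s j))
    fresh j j≢i = dn1 i i∈dom j j≢i v v∈sᵢ

    local : ∀ a → a ∈ B → ∀ j → _occursIn_ L v (lookup (Atom.args a) j) → τ (Atom.pred a) j ≡ true
    local a a∈B j v∈tⱼ = decidable-stable (τ (Atom.pred a) j ≟ true)
      λ τqj≢true → dn3 i i∈dom a a∈B j (τqj≢true ∘ InDom-toPositions⁺) v v∈sᵢ v∈tⱼ

proposition4 : (L : Language) (τ : Positions L) (x : Var L) →
    ((A B : Atom L) →
    MoreGeneral L (Δ[_] L τ) A B ⇔ MoreGeneral L (Δ⁺[_] L (toPositions⁺ L τ x)) A B)
    × ((c : Clause L) → DN L τ c ⇔ DN⁺ L (toPositions⁺ L τ x) c)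
proposition4 L τ x =
  (λ A B → mk⇔ (MoreGeneral-mono L (Δ[τ]⊑Δ⁺[τ⁺] L τ x) A B)
               (MoreGeneral-mono L (Δ⁺[τ⁺]⊑Δ[τ] L τ x) A B)) ,
  (λ c → mk⇔ (DN⇒DN⁺ L τ x c) (DN⁺⇒DN L τ x c))
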